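{- Let $T$ be an increasing tableau of shape $\nu/\lambda$, let $R$ be an increasing tableau of the straight shape $\lambda$, and fix $a\in\mathbb{N}$. Let $A$ be the subtableau of $T$ consisting of the entries from $1$ to $a$, and let $B=T\setminus A$ be the subtableau of remaining entries (those $>a$). Then $K\mathtt{infusion}_1(R,T)=K\mathtt{infusion}_1(R,A)\cup K\mathtt{infusion}_1(K\mathtt{infusion}_2(R,A),B)$.
   Context: Increasing tableau: filling of a skew shape by positive integers strictly increasing along rows and down columns (here a tableau such as $B$ may use a set of labels not starting at $1$; all operations only use the relative order of labels). $K$-jeu de taquin slide $K\mathtt{jdt}_{\{x_j\}}(V)$ for a nonempty set of inner corners $x_j$ (boxes $x$ of the inner shape $\lambda$ with $\lambda\setminus\{x\}$ a partition): put $\bullet$ in each $x_j$; for each label $i$ of $V$ in increasing order, in every edge-connected component with at least two boxes of the set of boxes containing $\bullet$ or $i$, interchange $\bullet$ and $i$; at the end the $\bullet$ boxes are the vacated "holes". For $P$ an increasing tableau of shape $\lambda/\alpha$ and $Q$ one of shape $\nu/\lambda$, $K\mathtt{infusion}(P,Q)$ is computed as follows: let $m$ be the largest label of $P$, at boxes $x_1,\ldots,x_k$; apply $K\mathtt{jdt}_{\{x_j\}}$ to the current $Q$ and put $m$ in the resulting holes; repeat with the next largest label of $P$, until all labels of $P$ are used. Then the $Q$-labels occupy a shape $\gamma/\alpha$ and the $P$-labels occupy $\nu/\gamma$; $K\mathtt{infusion}_1(P,Q)$ is the tableau of $Q$-labels on $\gamma/\alpha$ and $K\mathtt{infusion}_2(P,Q)$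 is the tableau of $P$-labels on $\nu/\gamma$. Union of tableaux means the filling of the union of their (disjoint) shapes. -}

module Defs where

open import Data.Nat using (ℕ; zero; suc; _≤_; _<_; _≡ᵇ_; _≤ᵇ_; _⊔_)
open import Data.Bool using (Bool; true; false; _∧_; _∨_; if_then_else_; not)
open import Data.Product using (_×_; _,_; proj₁; proj₂)
open import Data.List using (List; []; _∷_; map; filterᵇ; reverse; foldr; foldl; upTo; _++_)
open import Data.Bool.ListAction using (any)
open import Data.List.Membership.Propositional using (_∈_)
open import Data.List.Relation.Unary.Unique.Propositional using (Unique)
open import Relation.Nullary using (¬_)

-- Boxes, partitions, tableaux
-- A box is (row , column), both 0-indexed.
-- A tableau (filling) is a finite list of entries (box , label).

Box : Set
Box = ℕ × ℕ

Entry : Set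
Entry = Box × ℕ

Tableau : Set
Tableau = List Entry

nth : List ℕ → ℕ → ℕ
nth [] _ = 0
nth (x ∷ xs) zero = x
nth (x ∷ xs) (suc n) = nth xs n

-- a partition is a weakly decreasing list of naturals (trailing zeros harmless)
IsPartition : List ℕ → Set
IsPartition p = ∀ i j → i ≤ j → nth p j ≤ nth p i

_∈ₚ_ : Box → List ℕ → Set
(r , c) ∈ₚ p = c < nth p r

boxes : Tableau → List Box
boxes = map proj₁

record IsIncreasingTableau (T : Tableau) (outer inner : List ℕ) : Set where
  field
    outerPartition : IsPartition outer
    innerPartition : IsPartition inner
    contained      : ∀ r → nth inner r ≤ nth outer r
    uniqueBoxes    : Unique (boxes T)
    shapeSound     : ∀ b → b ∈ boxes T → (b ∈ₚ outer) × ¬ (b ∈ₚ inner)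
    shapeComplete  : ∀ b → b ∈ₚ outer → ¬ (b ∈ₚ inner) → b ∈ boxes T
    positive       : ∀ {b x} → (b , x) ∈ T → 1 ≤ x
    rowStrict      : ∀ {r c c′ x y} → ((r , c) , x) ∈ T → ((r , c′) , y) ∈ T → c < c′ → x < y
    colStrict      : ∀ {r r′ c x y} → ((r , c) , x) ∈ T → ((r′ , c) , y) ∈ T → r < r′ → x < y

_≐_ : Tableau → Tableau → Set
X ≐ Y = ∀ e → (e ∈ X → e ∈ Y) × (e ∈ Y → e ∈ X)

-- union of tableaux (on disjoint shapes)
_∪ₜ_ : Tableau → Tableau → Tableau
X ∪ₜ Y = X ++ Y

lowerPart : ℕ → Tableau → Tableau
lowerPart a = filterᵇ (λ e → proj₂ e ≤ᵇ a)

upperPart : ℕ → Tableau → Tableau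
upperPart a = filterᵇ (λ e → not (proj₂ e ≤ᵇ a))

maxLabel : Tableau → ℕ
maxLabel = foldr (λ e m → proj₂ e ⊔ m) 0

labelsOf : Tableau → List ℕ
labelsOf T = filterᵇ (λ i → any (λ e → proj₂ e ≡ᵇ i) T) (upTo (suc (maxLabel T)))

boxesWith : ℕ → Tableau → List Box
boxesWith m T = boxes (filterᵇ (λ e → proj₂ e ≡ᵇ m) T)

data Sym : Set where
  bullet : Sym
  lab    : ℕ → Sym

Cell : Set
Cell = Box × Sym

adjᵇ : Box → Box → Bool
adjᵇ (r , c) (r′ , c′) =
  ((r ≡ᵇ r′) ∧ ((suc c ≡ᵇ c′) ∨ (c ≡ᵇ suc c′))) ∨
  ((c ≡ᵇ c′) ∧ ((suc r ≡ᵇ r′) ∨ (r ≡ᵇ suc r′)))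

activeᵇ : ℕ → Sym → Bool
activeᵇ i bullet = true
activeᵇ i (lab j) = i ≡ᵇ j

swapSym : ℕ → Sym → Sym
swapSym i bullet = lab i
swapSym i (lab j) = if i ≡ᵇ j then bullet else lab j

-- One step for label i: a box of the set S of boxes containing • or i lies
-- in an edge-connected component of S with at least two boxes iff it has an
-- edge-neighbour in S; in such components • and i are interchanged.
jdtStep : ℕ → List Cell → List Cell
jdtStep i cs = map step cs
  where
  step : Cell → Cell
  step (b , s) =
    if activeᵇ i s ∧ any (λ c → activeᵇ i (proj₂ c) ∧ adjᵇ b (proj₁ c)) cs
    then (b , swapSym i s) else (b , s)

labelled : List Cell → Tableau
labelled [] = []
labelled ((b , bullet) ∷ cs) = labelled cs
labelled ((b , lab x) ∷ cs) = (b , x) ∷ labelled cs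

holesOf : List Cell → List Box
holesOf [] = []
holesOf ((b , bullet) ∷ cs) = b ∷ holesOf cs
holesOf ((b , lab x) ∷ cs) = holesOf cs

toCells : Tableau → List Cell
toCells = map (λ e → (proj₁ e , lab (proj₂ e)))

Kjdt : List Box → Tableau → Tableau × List Box
Kjdt xs V = labelled final , holesOf final
  where
  final : List Cell
  final = foldl (λ cs i → jdtStep i cs) (map (λ b → (b , bullet)) xs ++ toCells V) (labelsOf V)

Kinfusion : Tableau → Tableau → Tableau × Tableau
Kinfusion P Q = foldl step (Q , []) (reverse (labelsOf P))
  where
  step : Tableau × Tableau → ℕ → Tableau × Tableau
  step (Q′ , out) m =
    let r = Kjdt (boxesWith m P) Q′
    in proj₁ r , (out ++ map (λ b → (b , m)) (proj₂ r))

Kinfusion₁ : Tableau → Tableau → Tableau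
Kinfusion₁ P Q = proj₁ (Kinfusion P Q)

Kinfusion₂ : Tableau → Tableau → Tableau
Kinfusion₂ P Q = proj₂ (Kinfusion P Q)

-- K-infusion is a sequence of K-jeu de taquin slides, one per label m of R (in
-- decreasing order), started from the boxes of R labelled m.  A slide processes
-- labels in increasing order, and cells holding neither • nor the current label
-- are inert: they neither move nor influence other cells.  So a slide of A ∪ B,
-- all labels of A below those of B, is the slide of A followed by the slide of B
-- into the holes vacated by A (Kjdt-split).  Along the infusion these holes are
-- exactly the boxes of P labelled m, since m is placed at that step only
-- (infuse-split).  Finally the infusion of P into B runs over the same labels,
-- because P carries every label of R: adjacent cells of an increasing tableau hold
-- different symbols, slides preserve this, and then no slide loses all its holes.

module Submission where

open import Data.Bool using (Bool; true; false; _∧_; _∨_; if_then_else_; not; T)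
open import Data.Bool.Properties using (∨-identityʳ; ∨-assoc; ∨-comm; T-≡; T-∨; T-∧)
open import Data.Empty using (⊥; ⊥-elim)
open import Data.List using (List; []; _∷_; map; reverse; foldl; _++_)
open import Data.List.Properties using (map-++; map-id-local; foldl-++; ++-assoc; ++-identityʳ)
  renaming (map-cong to map-≗)
open import Data.Bool.ListAction using (any)
open import Data.List.Membership.Propositional using (_∈_; find; lose)
open import Data.List.Membership.Propositional.Properties
  using (∈-map⁺; ∈-map⁻; ∈-++⁺ˡ; ∈-++⁺ʳ; ∈-++⁻; ∈-filter⁺; ∈-filter⁻; ∈-upTo⁺)
open import Data.List.Membership.Propositional.Properties.WithK using (unique∧set⇒bag)
open import Data.List.Relation.Binary.BagAndSetEquality
  using (_∼[_]_; set; [_]-Equality; ++-cong; ∼bag⇒↭)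
  renaming (map-cong to map-∼)
open import Data.List.Relation.Binary.Subset.Propositional using (_⊆_)
open import Data.List.Relation.Binary.Subset.Propositional.Properties using (Any-resp-⊆; filter-⊆; map⁺)
open import Data.List.Relation.Binary.Equality.Propositional using (≋⇒≡)
open import Data.List.Relation.Binary.Permutation.Propositional using (↭⇒↭ₛ; ↭-sym)
open import Data.List.Relation.Binary.Permutation.Propositional.Properties using (↭-reverse)
open import Data.List.Relation.Binary.Permutation.Setoid.Properties using (Unique-resp-↭)
open import Data.List.Relation.Unary.All as All using (All)
open import Data.List.Relation.Unary.Any using (here; there)
open import Data.List.Relation.Unary.Any.Properties using (any⁺; any⁻; reverse⁺; reverse⁻)
open import Data.List.Relation.Unary.Unique.Propositional using (Unique)
open import Data.List.Relation.Unary.AllPairs as AllPairs using (AllPairs; _∷_)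
open import Data.List.Relation.Unary.AllPairs.Properties
  using (applyUpTo⁺₁) renaming (filter⁺ to AllPairs-filter⁺; ++⁺ to AllPairs-++⁺)
open import Data.List.Relation.Unary.Linked using (Linked)
open import Data.List.Relation.Unary.Linked.Properties using (AllPairs⇒Linked)
open import Data.List.Relation.Unary.Sorted.TotalOrder.Properties using (↗↭↗⇒≋)
open import Data.Nat using (ℕ; suc; _≤_; _<_; _≡ᵇ_; _≤ᵇ_; s≤s)
open import Data.Nat.Properties
  using ( ≡ᵇ⇒≡; ≡⇒≡ᵇ; _≟_; m≤m⊔n; m≤n⊔m; ≤-trans; <-irrefl; ≤-<-trans; <⇒≢; <⇒≤
        ; ≤ᵇ⇒≤; ≤⇒≤ᵇ; ≰⇒>; n<1+n; ≤-totalOrder)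
open import Data.Product using (_×_; _,_; proj₁; proj₂; ∃-syntax)
open import Data.Sum using (_⊎_; inj₁; inj₂)
open import Data.Unit using (tt)
open import Function using (_∘_; _⇔_; mk⇔; Equivalence)
open import Relation.Binary.Bundles using (Setoid)
open import Relation.Binary.PropositionalEquality
  using (_≡_; _≢_; refl; sym; trans; cong; cong₂; subst; setoid; module ≡-Reasoning)
import Relation.Binary.Reasoning.Setoid as SetoidReasoning
open import Relation.Nullary using (¬_)
open import Relation.Nullary.Decidable using (T?; dec-false)
open import Defs

private
  variable
    E : Set
    xs ys : List E
    i j m x : ℕ
    b : Box
    s : Sym
    cs ds : List Cell
    L : List ℕ

-- Two lists are set-equal when they have the same members; all the
-- tableau identities below hold only up to this relation.
infix 4 _∼_
_∼_ : List E → List E → Set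
xs ∼ ys = xs ∼[ set ] ys

module SetEq {E : Set} = Setoid ([ set ]-Equality E)

∼⇒⊆ : xs ∼ ys → xs ⊆ ys
∼⇒⊆ eq p = Equivalence.to eq p

∼⇒⊇ : xs ∼ ys → ys ⊆ xs
∼⇒⊇ eq p = Equivalence.from eq p

∼⇒≐ : ∀ {X Y : Tableau} → X ∼ Y → X ≐ Y
∼⇒≐ X∼Y e = Equivalence.to X∼Y , Equivalence.from X∼Y

T-injective : ∀ {u v} → (T u → T v) → (T v → T u) → u ≡ v
T-injective {false} {false} _ _ = refl
T-injective {false} {true}  _ g = ⊥-elim (g tt)
T-injective {true}  {false} f _ = ⊥-elim (f tt)
T-injective {true}  {true}  _ _ = refl

any-cong : (p : E → Bool) → xs ∼ ys → any p xs ≡ any p ys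
any-cong p eq = T-injective
  (any⁺ p ∘ Any-resp-⊆ (∼⇒⊆ eq) ∘ any⁻ p _)
  (any⁺ p ∘ Any-resp-⊆ (∼⇒⊇ eq) ∘ any⁻ p _)

any-++ : (p : E → Bool) (xs ys : List E) → any p (xs ++ ys) ≡ any p xs ∨ any p ys
any-++ p []       ys = refl
any-++ p (x ∷ xs) ys = trans (cong (p x ∨_) (any-++ p xs ys)) (sym (∨-assoc (p x) (any p xs) (any p ys)))

any-none : (p : E → Bool) → (∀ {x} → x ∈ xs → p x ≡ false) → any p xs ≡ false
any-none {xs = []}     p none = refl
any-none {xs = x ∷ xs} p none rewrite none (here refl) = any-none p (none ∘ there)

≢⇒≡ᵇ-false : i ≢ j → (i ≡ᵇ j) ≡ false
≢⇒≡ᵇ-false {i} {j} = dec-false (i ≟ j)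

≡ᵇ-refl : ∀ i → (i ≡ᵇ i) ≡ true
≡ᵇ-refl i = Equivalence.to T-≡ (≡⇒≡ᵇ i i refl)

HasLabel : Tableau → ℕ → Set
HasLabel X i = ∃[ b ] ((b , i) ∈ X)

-- `labelsOf X` scans 0 … maxLabel X, which bounds every label.
maxLabel-bound : ∀ {X : Tableau} → (b , x) ∈ X → x ≤ maxLabel X
maxLabel-bound {X = (_ , y) ∷ X} (here refl) = m≤m⊔n y (maxLabel X)
maxLabel-bound {X = (_ , y) ∷ X} (there p)   = ≤-trans (maxLabel-bound p) (m≤n⊔m y (maxLabel X))

∈-labelsOf : ∀ {X} → i ∈ labelsOf X ⇔ HasLabel X i
∈-labelsOf {i} {X} = mk⇔ to from
  where
  isLabel : ℕ → Bool
  isLabel k = any (λ e → proj₂ e ≡ᵇ k) X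
  to : i ∈ labelsOf X → HasLabel X i
  to p with (b , k) , e∈X , k≡ᵇi ← find (any⁻ _ X (proj₂ (∈-filter⁻ (T? ∘ isLabel) p)))
    with refl ← ≡ᵇ⇒≡ k i k≡ᵇi = b , e∈X
  from : HasLabel X i → i ∈ labelsOf X
  from (b , e∈X) = ∈-filter⁺ (T? ∘ isLabel) (∈-upTo⁺ (s≤s (maxLabel-bound e∈X)))
                     (any⁺ _ (lose e∈X (≡⇒≡ᵇ i i refl)))

labelsOf-increasing : ∀ X → AllPairs _<_ (labelsOf X)
labelsOf-increasing X =
  AllPairs-filter⁺ (T? ∘ λ k → any (λ e → proj₂ e ≡ᵇ k) X)
    (applyUpTo⁺₁ (λ k → k) (suc (maxLabel X)) (λ i<j _ → i<j))

increasing-unique : AllPairs _<_ xs → AllPairs _<_ ys → xs ∼ ys → xs ≡ ys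
increasing-unique xs< ys< xs∼ys = ≋⇒≡ (↗↭↗⇒≋ ≤-totalOrder (sorted xs<) (sorted ys<)
  (↭⇒↭ₛ (∼bag⇒↭ (unique∧set⇒bag (AllPairs.map <⇒≢ xs<) (AllPairs.map <⇒≢ ys<) xs∼ys))))
  where
  sorted : ∀ {zs} → AllPairs _<_ zs → Linked _≤_ zs
  sorted zs< = AllPairs⇒Linked (AllPairs.map <⇒≤ zs<)

labelsOf-unique : ∀ {X} → AllPairs _<_ L → (∀ {k} → k ∈ L ⇔ HasLabel X k) → labelsOf X ≡ L
labelsOf-unique {X = X} L< L⇔X = increasing-unique (labelsOf-increasing X) L<
  (mk⇔ (Equivalence.from L⇔X ∘ Equivalence.to ∈-labelsOf)
       (Equivalence.from ∈-labelsOf ∘ Equivalence.to L⇔X))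

labelsOf-cong : ∀ {X Y} → X ∼ Y → labelsOf X ≡ labelsOf Y
labelsOf-cong {X} {Y} X∼Y = labelsOf-unique (labelsOf-increasing Y)
  (mk⇔ (λ k∈ → transport (∼⇒⊇ X∼Y) (Equivalence.to ∈-labelsOf k∈))
       (λ k∈X → Equivalence.from ∈-labelsOf (transport (∼⇒⊆ X∼Y) k∈X)))
  where
  transport : ∀ {U V k} → U ⊆ V → HasLabel U k → HasLabel V k
  transport U⊆V (b , p) = b , U⊆V p

LabelsBelow : Tableau → Tableau → Set
LabelsBelow A B = ∀ {i j} → HasLabel A i → HasLabel B j → i < j

labelsOf-++ : ∀ {Z X Y} → LabelsBelow X Y → Z ∼ X ++ Y → labelsOf Z ≡ labelsOf X ++ labelsOf Y
labelsOf-++ {Z} {X} {Y} X<Y Z∼XY = labelsOf-unique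
  (AllPairs-++⁺ (labelsOf-increasing X) (labelsOf-increasing Y)
     (All.tabulate λ i∈ → All.tabulate λ j∈ →
        X<Y (Equivalence.to (∈-labelsOf {X = X}) i∈) (Equivalence.to (∈-labelsOf {X = Y}) j∈)))
  (mk⇔ to from)
  where
  to : ∀ {k} → k ∈ labelsOf X ++ labelsOf Y → HasLabel Z k
  to k∈ with ∈-++⁻ (labelsOf X) k∈
  ... | inj₁ k∈X with b , p ← Equivalence.to (∈-labelsOf {X = X}) k∈X = b , ∼⇒⊇ Z∼XY (∈-++⁺ˡ p)
  ... | inj₂ k∈Y with b , p ← Equivalence.to (∈-labelsOf {X = Y}) k∈Y = b , ∼⇒⊇ Z∼XY (∈-++⁺ʳ X p)
  from : ∀ {k} → HasLabel Z k → k ∈ labelsOf X ++ labelsOf Y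
  from (b , p) with ∈-++⁻ X (∼⇒⊆ Z∼XY p)
  ... | inj₁ q = ∈-++⁺ˡ (Equivalence.from (∈-labelsOf {X = X}) (b , q))
  ... | inj₂ q = ∈-++⁺ʳ (labelsOf X) (Equivalence.from (∈-labelsOf {X = Y}) (b , q))

bullets : List Box → List Cell
bullets = map (λ b → (b , bullet))

∈-bullets⁻ : (b , s) ∈ bullets xs → s ≡ bullet × b ∈ xs
∈-bullets⁻ p with b , b∈ , refl ← ∈-map⁻ _ p = refl , b∈

∈-toCells⁻ : ∀ {X} → (b , s) ∈ toCells X → ∃[ x ] (s ≡ lab x × (b , x) ∈ X)
∈-toCells⁻ p with (b , x) , e∈ , refl ← ∈-map⁻ _ p = x , refl , e∈

∈-labelled : (b , x) ∈ labelled cs ⇔ (b , lab x) ∈ cs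
∈-labelled = mk⇔ to from
  where
  to : ∀ {cs} → (b , x) ∈ labelled cs → (b , lab x) ∈ cs
  to {cs = (_ , bullet) ∷ cs} p           = there (to p)
  to {cs = (_ , lab _) ∷ cs}  (here refl) = here refl
  to {cs = (_ , lab _) ∷ cs}  (there p)   = there (to p)
  from : ∀ {cs} → (b , lab x) ∈ cs → (b , x) ∈ labelled cs
  from {cs = (_ , bullet) ∷ cs} (there p)   = from p
  from {cs = (_ , lab _) ∷ cs}  (here refl) = here refl
  from {cs = (_ , lab _) ∷ cs}  (there p)   = there (from p)

∈-holesOf : b ∈ holesOf cs ⇔ (b , bullet) ∈ cs
∈-holesOf = mk⇔ to from
  where
  to : ∀ {cs} → b ∈ holesOf cs → (b , bullet) ∈ cs
  to {cs = (_ , bullet) ∷ cs} (here refl) = here refl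
  to {cs = (_ , bullet) ∷ cs} (there p)   = there (to p)
  to {cs = (_ , lab _) ∷ cs}  p           = there (to p)
  from : ∀ {cs} → (b , bullet) ∈ cs → b ∈ holesOf cs
  from {cs = (_ , bullet) ∷ cs} (here refl) = here refl
  from {cs = (_ , bullet) ∷ cs} (there p)   = there (from p)
  from {cs = (_ , lab _) ∷ cs}  (there p)   = from p

cells-decompose : ∀ cs → cs ∼ toCells (labelled cs) ++ bullets (holesOf cs)
cells-decompose cs {b , bullet} = mk⇔
  (λ p → ∈-++⁺ʳ (toCells (labelled cs)) (∈-map⁺ _ (Equivalence.from ∈-holesOf p)))
  λ p → back (∈-++⁻ (toCells (labelled cs)) p)
  where
  back : (b , bullet) ∈ toCells (labelled cs) ⊎ (b , bullet) ∈ bullets (holesOf cs) → (b , bullet) ∈ cs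
  back (inj₁ q) with _ , () , _ ← ∈-toCells⁻ q
  back (inj₂ q) = Equivalence.to ∈-holesOf (proj₂ (∈-bullets⁻ q))
cells-decompose cs {b , lab x} = mk⇔
  (λ p → ∈-++⁺ˡ (∈-map⁺ _ (Equivalence.from ∈-labelled p)))
  λ p → back (∈-++⁻ (toCells (labelled cs)) p)
  where
  back : (b , lab x) ∈ toCells (labelled cs) ⊎ (b , lab x) ∈ bullets (holesOf cs) → (b , lab x) ∈ cs
  back (inj₁ q) with _ , refl , e∈ ← ∈-toCells⁻ q = Equivalence.to ∈-labelled e∈
  back (inj₂ q) with () , _ ← ∈-bullets⁻ q

labelled-cong : cs ∼ ds → labelled cs ∼ labelled ds
labelled-cong eq = mk⇔
  (λ p → Equivalence.from ∈-labelled (∼⇒⊆ eq (Equivalence.to ∈-labelled p)))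
  (λ p → Equivalence.from ∈-labelled (∼⇒⊇ eq (Equivalence.to ∈-labelled p)))

labelled-++ : ∀ cs ds → labelled (cs ++ ds) ≡ labelled cs ++ labelled ds
labelled-++ []                  ds = refl
labelled-++ ((b , bullet) ∷ cs) ds = labelled-++ cs ds
labelled-++ ((b , lab x) ∷ cs)  ds = cong ((b , x) ∷_) (labelled-++ cs ds)

labelled-toCells : ∀ X → labelled (toCells X) ≡ X
labelled-toCells []      = refl
labelled-toCells (e ∷ X) = cong (e ∷_) (labelled-toCells X)

hasNeighbour : ℕ → List Cell → Box → Bool
hasNeighbour i cs b = any (λ c → activeᵇ i (proj₂ c) ∧ adjᵇ b (proj₁ c)) cs

stepCell : ℕ → List Cell → Cell → Cell
stepCell i cs (b , s) =
  if activeᵇ i s ∧ hasNeighbour i cs b then (b , swapSym i s) else (b , s)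

Inert : ℕ → List Cell → Set
Inert i cs = ∀ {c} → c ∈ cs → activeᵇ i (proj₂ c) ≡ false

inert-labels : ∀ {X} → (∀ {j} → HasLabel X j → i ≢ j) → Inert i (toCells X)
inert-labels i∉X p with _ , refl , e∈ ← ∈-toCells⁻ p = ≢⇒≡ᵇ-false (i∉X (_ , e∈))

stepCell-inert : Inert i cs → ∀ {c} → c ∈ cs → stepCell i ds c ≡ c
stepCell-inert inert {b , s} p rewrite inert p = refl

hasNeighbour-++ : ∀ i cs ds → hasNeighbour i (cs ++ ds) b ≡ hasNeighbour i cs b ∨ hasNeighbour i ds b
hasNeighbour-++ i = any-++ _

hasNeighbour-inert : Inert i ds → hasNeighbour i ds b ≡ false
hasNeighbour-inert {b = b} inert = any-none _ (λ p → cong (_∧ adjᵇ b _) (inert p))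

jdtStep-frameʳ : ∀ i cs ds → Inert i ds → jdtStep i (cs ++ ds) ≡ jdtStep i cs ++ ds
jdtStep-frameʳ i cs ds inert = trans (map-++ (stepCell i (cs ++ ds)) cs ds)
  (cong₂ _++_ (map-≗ ignore cs) (map-id-local (All.tabulate (stepCell-inert {ds = cs ++ ds} inert))))
  where
  ignore : ∀ c → stepCell i (cs ++ ds) c ≡ stepCell i cs c
  ignore (b , s) rewrite hasNeighbour-++ {b = b} i cs ds | hasNeighbour-inert {b = b} inert
                       | ∨-identityʳ (hasNeighbour i cs b) = refl

jdtStep-frameˡ : ∀ i cs ds → Inert i ds → jdtStep i (ds ++ cs) ≡ ds ++ jdtStep i cs
jdtStep-frameˡ i cs ds inert = trans (map-++ (stepCell i (ds ++ cs)) ds cs)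
  (cong₂ _++_ (map-id-local (All.tabulate (stepCell-inert {ds = ds ++ cs} inert))) (map-≗ ignore cs))
  where
  ignore : ∀ c → stepCell i (ds ++ cs) c ≡ stepCell i cs c
  ignore (b , s) rewrite hasNeighbour-++ {b = b} i ds cs | hasNeighbour-inert {b = b} inert = refl

jdtStep-cong : ∀ i → cs ∼ ds → jdtStep i cs ∼ jdtStep i ds
jdtStep-cong {cs} {ds} i eq = SetEq.trans
  (SetEq.reflexive (map-≗ same-update cs))
  (map-∼ (λ _ → refl) eq)
  where
  same-update : ∀ c → stepCell i cs c ≡ stepCell i ds c
  same-update (b , s) rewrite any-cong (λ c → activeᵇ i (proj₂ c) ∧ adjᵇ b (proj₁ c)) eq = refl

slideCells : List ℕ → List Cell → List Cell
slideCells L cs = foldl (λ cs i → jdtStep i cs) cs L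

slideCells-cong : ∀ L → cs ∼ ds → slideCells L cs ∼ slideCells L ds
slideCells-cong []      eq = eq
slideCells-cong (i ∷ L) eq = slideCells-cong L (jdtStep-cong i eq)

slideCells-frameʳ : ∀ L cs ds → (∀ {i} → i ∈ L → Inert i ds) →
  slideCells L (cs ++ ds) ≡ slideCells L cs ++ ds
slideCells-frameʳ []      cs ds inert = refl
slideCells-frameʳ (i ∷ L) cs ds inert =
  trans (cong (slideCells L) (jdtStep-frameʳ i cs ds (inert (here refl))))
        (slideCells-frameʳ L (jdtStep i cs) ds (inert ∘ there))

slideCells-frameˡ : ∀ L cs ds → (∀ {i} → i ∈ L → Inert i ds) →
  slideCells L (ds ++ cs) ≡ ds ++ slideCells L cs
slideCells-frameˡ []      cs ds inert = refl
slideCells-frameˡ (i ∷ L) cs ds inert =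
  trans (cong (slideCells L) (jdtStep-frameˡ i cs ds (inert (here refl))))
        (slideCells-frameˡ L (jdtStep i cs) ds (inert ∘ there))

stepCell-label : ∀ i cs c → stepCell i cs c ≡ (b , lab x) → x ≡ i ⊎ c ≡ (b , lab x)
stepCell-label i cs (b , s) eq with activeᵇ i s ∧ hasNeighbour i cs b
stepCell-label i cs (b , s)      refl | false = inj₂ refl
stepCell-label i cs (b , bullet) refl | true  = inj₁ refl
stepCell-label i cs (b , lab j)  eq   | true with i ≡ᵇ j
stepCell-label i cs (b , lab j)  ()   | true | true
stepCell-label i cs (b , lab j)  refl | true | false = inj₂ refl

slideCells-label : ∀ L cs → (b , lab x) ∈ slideCells L cs → x ∈ L ⊎ ∃[ b′ ] ((b′ , lab x) ∈ cs)
slideCells-label []      cs p = inj₂ (_ , p)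
slideCells-label (i ∷ L) cs p with slideCells-label L (jdtStep i cs) p
... | inj₁ x∈L = inj₁ (there x∈L)
... | inj₂ (b′ , q) with c , c∈ , eq ← ∈-map⁻ (stepCell i cs) q with stepCell-label i cs c (sym eq)
...   | inj₁ refl = inj₁ (here refl)
...   | inj₂ refl = inj₂ (b′ , c∈)

initialCells : List Box → Tableau → List Cell
initialCells xs V = bullets xs ++ toCells V

finalCells : List Box → Tableau → List Cell
finalCells xs V = slideCells (labelsOf V) (initialCells xs V)

Kjdt-labels : ∀ xs V → HasLabel (proj₁ (Kjdt xs V)) x → HasLabel V x
Kjdt-labels xs V (b , p) with slideCells-label (labelsOf V) (initialCells xs V) (Equivalence.to ∈-labelled p)
... | inj₁ x∈L = Equivalence.to ∈-labelsOf x∈L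
... | inj₂ (b′ , q) with ∈-++⁻ (bullets xs) q
...   | inj₁ r with () , _ ← ∈-bullets⁻ r
...   | inj₂ r with _ , refl , e∈ ← ∈-toCells⁻ r = b′ , e∈

Kjdt-cong : ∀ {xs ys V W} → xs ∼ ys → V ∼ W → proj₁ (Kjdt xs V) ∼ proj₁ (Kjdt ys W)
Kjdt-cong {xs} {ys} {V} {W} xs∼ys V∼W = labelled-cong (begin
  slideCells (labelsOf V) (initialCells xs V)
    ≡⟨ cong (λ L → slideCells L (initialCells xs V)) (labelsOf-cong V∼W) ⟩
  slideCells (labelsOf W) (initialCells xs V)
    ≈⟨ slideCells-cong (labelsOf W) initial∼ ⟩
  slideCells (labelsOf W) (initialCells ys W) ∎)
  where
  open SetoidReasoning ([ set ]-Equality Cell)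
  initial∼ : initialCells xs V ∼ initialCells ys W
  initial∼ = ++-cong (map-∼ (λ _ → refl) xs∼ys) (map-∼ (λ _ → refl) V∼W)

module _ {xs : List Box} {V A B : Tableau} (V∼AB : V ∼ A ++ B) (A<B : LabelsBelow A B) where
  private
    LA LB : List ℕ
    LA = labelsOf A
    LB = labelsOf B
    fA : List Cell
    fA = finalCells xs A

    B-inert : ∀ {i} → i ∈ LA → Inert i (toCells B)
    B-inert {i} i∈ = inert-labels λ j∈B → <⇒≢ (A<B (Equivalence.to ∈-labelsOf i∈) j∈B)

    A-inert : ∀ {i} → i ∈ LB → Inert i (toCells (labelled fA))
    A-inert {i} i∈ = inert-labels λ j∈ i≡j →
      <⇒≢ (A<B (Kjdt-labels xs A j∈) (Equivalence.to ∈-labelsOf i∈)) (sym i≡j)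

    initial-split : initialCells xs V ∼ initialCells xs A ++ toCells B
    initial-split = SetEq.trans
      (++-cong SetEq.refl (SetEq.trans (map-∼ (λ _ → refl) V∼AB) (SetEq.reflexive (map-++ _ A B))))
      (SetEq.reflexive (sym (++-assoc (bullets xs) (toCells A) (toCells B))))

  finalCells-split : finalCells xs V ∼ toCells (labelled fA) ++ finalCells (holesOf fA) B
  finalCells-split = begin
    slideCells (labelsOf V) (initialCells xs V)
      ≡⟨ cong (λ L → slideCells L (initialCells xs V)) (labelsOf-++ A<B V∼AB) ⟩
    slideCells (LA ++ LB) (initialCells xs V)
      ≈⟨ slideCells-cong (LA ++ LB) initial-split ⟩
    slideCells (LA ++ LB) (initialCells xs A ++ toCells B)
      ≡⟨ foldl-++ _ _ LA LB ⟩
    slideCells LB (slideCells LA (initialCells xs A ++ toCells B))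
      ≡⟨ cong (slideCells LB) (slideCells-frameʳ LA (initialCells xs A) (toCells B) B-inert) ⟩
    slideCells LB (fA ++ toCells B)
      ≈⟨ slideCells-cong LB (++-cong (cells-decompose fA) SetEq.refl) ⟩
    slideCells LB ((toCells (labelled fA) ++ bullets (holesOf fA)) ++ toCells B)
      ≡⟨ cong (slideCells LB) (++-assoc (toCells (labelled fA)) _ _) ⟩
    slideCells LB (toCells (labelled fA) ++ initialCells (holesOf fA) B)
      ≡⟨ slideCells-frameˡ LB (initialCells (holesOf fA) B) (toCells (labelled fA)) A-inert ⟩
    toCells (labelled fA) ++ finalCells (holesOf fA) B ∎
    where open SetoidReasoning ([ set ]-Equality Cell)

  Kjdt-split : proj₁ (Kjdt xs V) ∼ proj₁ (Kjdt xs A) ++ proj₁ (Kjdt (proj₂ (Kjdt xs A)) B)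
  Kjdt-split = SetEq.trans (labelled-cong finalCells-split) (SetEq.reflexive labelled-split)
    where
    labelled-split : labelled (toCells (labelled fA) ++ finalCells (holesOf fA) B)
                   ≡ labelled fA ++ labelled (finalCells (holesOf fA) B)
    labelled-split = trans (labelled-++ (toCells (labelled fA)) (finalCells (holesOf fA) B))
                           (cong (_++ labelled (finalCells (holesOf fA) B)) (labelled-toCells (labelled fA)))

≡ᵇ-comm : ∀ i j → (i ≡ᵇ j) ≡ (j ≡ᵇ i)
≡ᵇ-comm i j = T-injective (≡⇒≡ᵇ j i ∘ sym ∘ ≡ᵇ⇒≡ i j) (≡⇒≡ᵇ i j ∘ sym ∘ ≡ᵇ⇒≡ j i)

adjᵇ-sym : ∀ b b′ → adjᵇ b b′ ≡ adjᵇ b′ b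
adjᵇ-sym (r , c) (r′ , c′)
  rewrite ≡ᵇ-comm r r′ | ≡ᵇ-comm c c′ | ≡ᵇ-comm (suc c) c′ | ≡ᵇ-comm c (suc c′)
        | ≡ᵇ-comm (suc r) r′ | ≡ᵇ-comm r (suc r′)
        | ∨-comm (c′ ≡ᵇ suc c) (suc c′ ≡ᵇ c) | ∨-comm (r′ ≡ᵇ suc r) (suc r′ ≡ᵇ r) = refl

Separated : List Cell → Set
Separated cs = ∀ {b s b′ s′} → (b , s) ∈ cs → (b′ , s′) ∈ cs → adjᵇ b b′ ≡ true → s ≢ s′

Separated-⊆ : cs ⊆ ds → Separated ds → Separated cs
Separated-⊆ cs⊆ds sep p q = sep (cs⊆ds p) (cs⊆ds q)

update : ℕ → Bool → Sym → Sym
update i n s = if activeᵇ i s ∧ n then swapSym i s else s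

stepCell-update : ∀ i cs b s → stepCell i cs (b , s) ≡ (b , update i (hasNeighbour i cs b) s)
stepCell-update i cs b s with activeᵇ i s ∧ hasNeighbour i cs b
... | true  = refl
... | false = refl

active-cases : ∀ i s → activeᵇ i s ≡ true → s ≡ bullet ⊎ s ≡ lab i
active-cases i bullet  _ = inj₁ refl
active-cases i (lab j) a = inj₂ (cong lab (sym (≡ᵇ⇒≡ i j (Equivalence.from T-≡ a))))

swapSym-moving : ∀ i → swapSym i (lab i) ≡ bullet
swapSym-moving i rewrite ≡ᵇ-refl i = refl

active-update : ∀ i n s → activeᵇ i (update i n s) ≡ activeᵇ i s
active-update i false bullet  = refl
active-update i true  bullet  = ≡ᵇ-refl i
active-update i n     (lab j) with i ≡ᵇ j in e
active-update i false (lab j) | true  rewrite e = refl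
active-update i true  (lab j) | true  = refl
active-update i n     (lab j) | false rewrite e = refl

swapSym-injective : ∀ i {s s′} → activeᵇ i s ≡ true → activeᵇ i s′ ≡ true →
  swapSym i s ≡ swapSym i s′ → s ≡ s′
swapSym-injective i {s} {s′} a a′ eq with active-cases i s a | active-cases i s′ a′
... | inj₁ refl | inj₁ refl = refl
... | inj₂ refl | inj₂ refl = refl
... | inj₁ refl | inj₂ refl rewrite ≡ᵇ-refl i with () ← eq
... | inj₂ refl | inj₁ refl rewrite ≡ᵇ-refl i with () ← eq

update-inert : ∀ i n {s} → activeᵇ i s ≡ false → update i n s ≡ s
update-inert i n a rewrite a = refl

update-active : ∀ i {n} s → activeᵇ i s ≡ true → n ≡ true → update i n s ≡ swapSym i s
update-active i s a refl rewrite a = refl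

-- Adjacent distinct symbols stay distinct; the hypothesis says that when both are
-- active, both see an active neighbour (namely each other).
update-separates : ∀ i {n n′ s s′} → s ≢ s′ →
  (activeᵇ i s ≡ true → activeᵇ i s′ ≡ true → n ≡ true × n′ ≡ true) →
  update i n s ≢ update i n′ s′
update-separates i {n} {n′} {s} {s′} s≢s′ both eq = by-activity (activeᵇ i s) refl
  where
  same-activity : activeᵇ i s ≡ activeᵇ i s′
  same-activity = trans (sym (active-update i n s)) (trans (cong (activeᵇ i) eq) (active-update i n′ s′))
  by-activity : ∀ v → activeᵇ i s ≡ v → ⊥
  by-activity false a = s≢s′ (begin
    s               ≡⟨ update-inert i n a ⟨
    update i n s    ≡⟨ eq ⟩
    update i n′ s′  ≡⟨ update-inert i n′ (trans (sym same-activity) a) ⟩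
    s′              ∎)
    where open ≡-Reasoning
  by-activity true a = s≢s′ (swapSym-injective i a a′ (begin
    swapSym i s     ≡⟨ update-active i s a (proj₁ (both a a′)) ⟨
    update i n s    ≡⟨ eq ⟩
    update i n′ s′  ≡⟨ update-active i s′ a′ (proj₂ (both a a′)) ⟩
    swapSym i s′    ∎))
    where
    open ≡-Reasoning
    a′ : activeᵇ i s′ ≡ true
    a′ = trans (sym same-activity) a

hasNeighbour-intro : ∀ i cs {b b′ s′} → (b′ , s′) ∈ cs → activeᵇ i s′ ≡ true → adjᵇ b b′ ≡ true →
  hasNeighbour i cs b ≡ true
hasNeighbour-intro i cs {b} p a adj = Equivalence.to T-≡
  (any⁺ _ (lose p (Equivalence.from T-≡ (trans (cong (_∧ adjᵇ b _) a) adj))))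

jdtStep-separated : ∀ i cs → Separated cs → Separated (jdtStep i cs)
jdtStep-separated i cs sep p q adj
  with (b₁ , s₁) , p₁ , e₁ ← ∈-map⁻ (stepCell i cs) p
     | (b₂ , s₂) , p₂ , e₂ ← ∈-map⁻ (stepCell i cs) q
  rewrite stepCell-update i cs b₁ s₁ | stepCell-update i cs b₂ s₂ with refl ← e₁ | refl ← e₂ =
  update-separates i (sep p₁ p₂ adj) λ a₁ a₂ →
    hasNeighbour-intro i cs {b₁} p₂ a₂ adj ,
    hasNeighbour-intro i cs {b₂} p₁ a₁ (trans (adjᵇ-sym b₂ b₁) adj)

-- A hole either stays put or is filled by an adjacent i, which leaves a hole behind.
jdtStep-keeps-hole : ∀ i cs → Separated cs → (b , bullet) ∈ cs →
  ∃[ b′ ] ((b′ , bullet) ∈ jdtStep i cs)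
jdtStep-keeps-hole {b} i cs sep p with hasNeighbour i cs b in nb
... | false = b , subst (_∈ jdtStep i cs) stays (∈-map⁺ (stepCell i cs) p)
  where
  stays : stepCell i cs (b , bullet) ≡ (b , bullet)
  stays = trans (stepCell-update i cs b bullet) (cong (λ n → (b , update i n bullet)) nb)
... | true with (b′ , s′) , q , a∧adj ← find (any⁻ _ cs (Equivalence.from T-≡ nb))
  with a , adj ← Equivalence.to T-∧ a∧adj
  with active-cases i s′ (Equivalence.to T-≡ a)
...   | inj₁ refl = ⊥-elim (sep p q (Equivalence.to T-≡ adj) refl)
...   | inj₂ refl = b′ , subst (_∈ jdtStep i cs) vacates (∈-map⁺ (stepCell i cs) q)
  where
  vacates : stepCell i cs (b′ , lab i) ≡ (b′ , bullet)
  vacates = trans (stepCell-update i cs b′ (lab i)) (cong (b′ ,_) (trans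
    (update-active i (lab i) (≡ᵇ-refl i)
      (hasNeighbour-intro i cs {b′} p refl (trans (adjᵇ-sym b′ b) (Equivalence.to T-≡ adj))))
    (swapSym-moving i)))

slideCells-separated : ∀ L cs → Separated cs → Separated (slideCells L cs)
slideCells-separated []      cs sep = sep
slideCells-separated (i ∷ L) cs sep = slideCells-separated L (jdtStep i cs) (jdtStep-separated i cs sep)

slideCells-keeps-hole : ∀ L cs → Separated cs → (b , bullet) ∈ cs →
  ∃[ b′ ] ((b′ , bullet) ∈ slideCells L cs)
slideCells-keeps-hole []      cs sep p = _ , p
slideCells-keeps-hole (i ∷ L) cs sep p with b′ , q ← jdtStep-keeps-hole i cs sep p =
  slideCells-keeps-hole L (jdtStep i cs) (jdtStep-separated i cs sep) q

initial-separated : ∀ xs V → Separated (bullets xs) → Separated (toCells V) → Separated (initialCells xs V)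
initial-separated xs V sepxs sepV p q adj with ∈-++⁻ (bullets xs) p | ∈-++⁻ (bullets xs) q
... | inj₁ p′ | inj₁ q′ = sepxs p′ q′ adj
... | inj₂ p′ | inj₂ q′ = sepV p′ q′ adj
... | inj₁ p′ | inj₂ q′ with refl , _ ← ∈-bullets⁻ p′ | _ , refl , _ ← ∈-toCells⁻ q′ = λ ()
... | inj₂ p′ | inj₁ q′ with _ , refl , _ ← ∈-toCells⁻ p′ | refl , _ ← ∈-bullets⁻ q′ = λ ()

module _ (xs : List Box) (V : Tableau) (sepxs : Separated (bullets xs)) (sepV : Separated (toCells V)) where

  Kjdt-separated : Separated (toCells (proj₁ (Kjdt xs V)))
  Kjdt-separated = Separated-⊆ labelled⊆
    (slideCells-separated (labelsOf V) (initialCells xs V) (initial-separated xs V sepxs sepV))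
    where
    labelled⊆ : toCells (proj₁ (Kjdt xs V)) ⊆ finalCells xs V
    labelled⊆ p with _ , refl , e∈ ← ∈-toCells⁻ p = Equivalence.to ∈-labelled e∈

  Kjdt-vacates : b ∈ xs → ∃[ b′ ] (b′ ∈ proj₂ (Kjdt xs V))
  Kjdt-vacates b∈ with b′ , q ← slideCells-keeps-hole (labelsOf V) (initialCells xs V)
                                  (initial-separated xs V sepxs sepV) (∈-++⁺ˡ (∈-map⁺ _ b∈)) =
    b′ , Equivalence.from ∈-holesOf q

placed : ℕ → List Box → Tableau
placed m = map (λ b → (b , m))

infuse₁ : Tableau → List ℕ → Tableau → Tableau
infuse₁ P []       Q = Q
infuse₁ P (m ∷ ms) Q = infuse₁ P ms (proj₁ (Kjdt (boxesWith m P) Q))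

infuse₂ : Tableau → List ℕ → Tableau → Tableau
infuse₂ P []       Q = []
infuse₂ P (m ∷ ms) Q =
  placed m (proj₂ (Kjdt (boxesWith m P) Q)) ++ infuse₂ P ms (proj₁ (Kjdt (boxesWith m P) Q))

infusionStep : Tableau → Tableau × Tableau → ℕ → Tableau × Tableau
infusionStep P (Q , out) m =
  proj₁ (Kjdt (boxesWith m P) Q) , out ++ placed m (proj₂ (Kjdt (boxesWith m P) Q))

foldl-infusionStep : ∀ P ms Q out →
  foldl (infusionStep P) (Q , out) ms ≡ (infuse₁ P ms Q , out ++ infuse₂ P ms Q)
foldl-infusionStep P []       Q out = cong (Q ,_) (sym (++-identityʳ out))
foldl-infusionStep P (m ∷ ms) Q out =
  trans (foldl-infusionStep P ms _ _) (cong (_ ,_) (++-assoc out _ (infuse₂ P ms _)))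

Kinfusion-unfold : ∀ P Q →
  Kinfusion P Q ≡ (infuse₁ P (reverse (labelsOf P)) Q , infuse₂ P (reverse (labelsOf P)) Q)
Kinfusion-unfold P Q = foldl-infusionStep P (reverse (labelsOf P)) Q []

descending-labels-distinct : ∀ X → Unique (reverse (labelsOf X))
descending-labels-distinct X = Unique-resp-↭ (setoid ℕ) (↭⇒↭ₛ (↭-sym (↭-reverse (labelsOf X))))
  (AllPairs.map <⇒≢ (labelsOf-increasing X))

infuse₂-labels : ∀ P ms Q {b x} → (b , x) ∈ infuse₂ P ms Q → x ∈ ms
infuse₂-labels P (m ∷ ms) Q p with ∈-++⁻ (placed m _) p
... | inj₁ q with _ , _ , refl ← ∈-map⁻ (λ b → (b , m)) q = here refl
... | inj₂ q = there (infuse₂-labels P ms _ q)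

∈-boxesWith : ∀ {X} → b ∈ boxesWith m X ⇔ (b , m) ∈ X
∈-boxesWith {b} {m} {X} = mk⇔ to from
  where
  to : b ∈ boxesWith m X → (b , m) ∈ X
  to p with (b , k) , q , refl ← ∈-map⁻ proj₁ p
    with e∈ , k≡ᵇm ← ∈-filter⁻ (T? ∘ λ e → proj₂ e ≡ᵇ m) {xs = X} q
    with refl ← ≡ᵇ⇒≡ k m k≡ᵇm = e∈
  from : (b , m) ∈ X → b ∈ boxesWith m X
  from p = ∈-map⁺ proj₁ (∈-filter⁺ (T? ∘ λ e → proj₂ e ≡ᵇ m) p (≡⇒≡ᵇ m m refl))

boxesWith-separated : ∀ {X} → Separated (toCells X) → Separated (bullets (boxesWith m X))
boxesWith-separated sep p q adj _ with refl , b∈ ← ∈-bullets⁻ p | refl , b′∈ ← ∈-bullets⁻ q =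
  sep (∈-map⁺ _ (Equivalence.to ∈-boxesWith b∈)) (∈-map⁺ _ (Equivalence.to ∈-boxesWith b′∈)) adj refl

boxesWith-fresh : ∀ h X → ¬ HasLabel X m → boxesWith m (placed m h ++ X) ∼ h
boxesWith-fresh {m} h X fresh {b} = mk⇔ to from
  where
  to : b ∈ boxesWith m (placed m h ++ X) → b ∈ h
  to p with ∈-++⁻ (placed m h) (Equivalence.to ∈-boxesWith p)
  ... | inj₁ q with _ , b∈ , refl ← ∈-map⁻ (λ b → (b , m)) q = b∈
  ... | inj₂ q = ⊥-elim (fresh (b , q))
  from : b ∈ h → b ∈ boxesWith m (placed m h ++ X)
  from b∈ = Equivalence.from ∈-boxesWith (∈-++⁺ˡ (∈-map⁺ _ b∈))

boxesWith-other : ∀ h X {k} → k ≢ m → boxesWith k (placed m h ++ X) ∼ boxesWith k X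
boxesWith-other {m} h X {k} k≢m {b} = mk⇔ to from
  where
  to : b ∈ boxesWith k (placed m h ++ X) → b ∈ boxesWith k X
  to p with ∈-++⁻ (placed m h) (Equivalence.to ∈-boxesWith p)
  ... | inj₁ q with _ , _ , refl ← ∈-map⁻ (λ b → (b , m)) q = ⊥-elim (k≢m refl)
  ... | inj₂ q = Equivalence.from ∈-boxesWith q
  from : b ∈ boxesWith k X → b ∈ boxesWith k (placed m h ++ X)
  from p = Equivalence.from ∈-boxesWith (∈-++⁺ʳ (placed m h) (Equivalence.to ∈-boxesWith p))

AgreeOn : List ℕ → Tableau → Tableau → Set
AgreeOn ms P P′ = ∀ {m} → m ∈ ms → boxesWith m P ∼ boxesWith m P′

infuse-split : ∀ R P ms {T A B} → Unique ms → AgreeOn ms P (infuse₂ R ms A) →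
  T ∼ A ++ B → LabelsBelow A B → infuse₁ R ms T ∼ infuse₁ R ms A ++ infuse₁ P ms B
infuse-split R P []       _                agree T∼AB A<B = T∼AB
infuse-split R P (m ∷ ms) {T} {A} {B} (m∉ms ∷ distinct) agree T∼AB A<B =
  infuse-split R P ms distinct agree′ T′∼A′B′ A′<B′
  where
  Rm h : List Box
  Rm = boxesWith m R
  h  = proj₂ (Kjdt Rm A)
  A′ B′ : Tableau
  A′ = proj₁ (Kjdt Rm A)
  B′ = proj₁ (Kjdt (boxesWith m P) B)

  P-at-m : boxesWith m P ∼ h
  P-at-m = SetEq.trans (agree (here refl))
    (boxesWith-fresh h (infuse₂ R ms A′) λ (_ , p) → All.lookup m∉ms (infuse₂-labels R ms A′ p) refl)

  T′∼A′B′ : proj₁ (Kjdt Rm T) ∼ A′ ++ B′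
  T′∼A′B′ = SetEq.trans (Kjdt-split {xs = Rm} T∼AB A<B)
    (++-cong SetEq.refl (Kjdt-cong {V = B} (SetEq.sym P-at-m) SetEq.refl))

  A′<B′ : LabelsBelow A′ B′
  A′<B′ p q = A<B (Kjdt-labels Rm A p) (Kjdt-labels (boxesWith m P) B q)

  agree′ : AgreeOn ms P (infuse₂ R ms A′)
  agree′ k∈ms = SetEq.trans (agree (there k∈ms))
    (boxesWith-other h (infuse₂ R ms A′) (λ k≡m → All.lookup m∉ms k∈ms (sym k≡m)))

infuse₂-complete : ∀ R ms Q → Separated (toCells R) → Separated (toCells Q) →
  (∀ {m} → m ∈ ms → HasLabel R m) → ∀ {m} → m ∈ ms → HasLabel (infuse₂ R ms Q) m
infuse₂-complete R (m ∷ ms) Q sepR sepQ inR (here refl)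
  with b , b∈ ← inR (here refl)
  with b′ , b′∈ ← Kjdt-vacates (boxesWith m R) Q (boxesWith-separated sepR) sepQ
                                (Equivalence.from ∈-boxesWith b∈) =
  b′ , ∈-++⁺ˡ (∈-map⁺ (λ b → (b , m)) b′∈)
infuse₂-complete R (m ∷ ms) Q sepR sepQ inR (there k∈)
  with b , p ← infuse₂-complete R ms (proj₁ (Kjdt (boxesWith m R) Q)) sepR
                 (Kjdt-separated (boxesWith m R) Q (boxesWith-separated sepR) sepQ) (inR ∘ there) k∈ =
  b , ∈-++⁺ʳ (placed m _) p

labelsOf-Kinfusion₂ : ∀ R Q → Separated (toCells R) → Separated (toCells Q) →
  labelsOf (Kinfusion₂ R Q) ≡ labelsOf R
labelsOf-Kinfusion₂ R Q sepR sepQ = trans (cong (labelsOf ∘ proj₂) (Kinfusion-unfold R Q))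
  (labelsOf-unique (labelsOf-increasing R) (mk⇔
    (infuse₂-complete R ms Q sepR sepQ (Equivalence.to ∈-labelsOf ∘ reverse⁻) ∘ reverse⁺)
    (λ (_ , p) → reverse⁻ (infuse₂-labels R ms Q p))))
  where
  ms : List ℕ
  ms = reverse (labelsOf R)

data Neighbours : Box → Box → Set where
  right : ∀ {r c} → Neighbours (r , c) (r , suc c)
  below : ∀ {r c} → Neighbours (r , c) (suc r , c)

adjᵇ-neighbours : ∀ b b′ → adjᵇ b b′ ≡ true → Neighbours b b′ ⊎ Neighbours b′ b
adjᵇ-neighbours (r , c) (r′ , c′) adj with Equivalence.to T-∨ (Equivalence.from T-≡ adj)
... | inj₁ same-row with r≡ , cs ← Equivalence.to T-∧ same-row with refl ← ≡ᵇ⇒≡ r r′ r≡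
                      with Equivalence.to T-∨ cs
...   | inj₁ c< with refl ← ≡ᵇ⇒≡ (suc c) c′ c< = inj₁ right
...   | inj₂ c> with refl ← ≡ᵇ⇒≡ c (suc c′) c> = inj₂ right
adjᵇ-neighbours (r , c) (r′ , c′) adj
    | inj₂ same-col with c≡ , rs ← Equivalence.to T-∧ same-col with refl ← ≡ᵇ⇒≡ c c′ c≡
                      with Equivalence.to T-∨ rs
...   | inj₁ r< with refl ← ≡ᵇ⇒≡ (suc r) r′ r< = inj₁ below
...   | inj₂ r> with refl ← ≡ᵇ⇒≡ r (suc r′) r> = inj₂ below

module _ {X : Tableau} {outer inner : List ℕ} (X-inc : IsIncreasingTableau X outer inner) where
  open IsIncreasingTableau X-inc

  neighbours-increase : ∀ {b b′ x y} → (b , x) ∈ X → (b′ , y) ∈ X → Neighbours b b′ → x < y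
  neighbours-increase p q (right {c = c}) = rowStrict p q (n<1+n c)
  neighbours-increase p q (below {r = r}) = colStrict p q (n<1+n r)

  increasing-separated : Separated (toCells X)
  increasing-separated {b} {_} {b′} p q adj eq
    with x , refl , p′ ← ∈-toCells⁻ p | y , refl , q′ ← ∈-toCells⁻ q
    with refl ← eq
    with adjᵇ-neighbours b b′ adj
  ... | inj₁ b→b′ = <-irrefl refl (neighbours-increase p′ q′ b→b′)
  ... | inj₂ b′→b = <-irrefl refl (neighbours-increase q′ p′ b′→b)

lowerPart-⊆ : ∀ a (X : Tableau) → lowerPart a X ⊆ X
lowerPart-⊆ a X = filter-⊆ (T? ∘ λ e → proj₂ e ≤ᵇ a) X

lower-upper-split : ∀ a (X : Tableau) → X ∼ lowerPart a X ++ upperPart a X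
lower-upper-split a X {e} = mk⇔ to from
  where
  low? = T? ∘ λ (e : Entry) → proj₂ e ≤ᵇ a
  high? = T? ∘ λ (e : Entry) → not (proj₂ e ≤ᵇ a)
  to : e ∈ X → e ∈ lowerPart a X ++ upperPart a X
  to p with proj₂ e ≤ᵇ a in le
  ... | true  = ∈-++⁺ˡ (∈-filter⁺ low? p (subst T (sym le) tt))
  ... | false = ∈-++⁺ʳ (lowerPart a X) (∈-filter⁺ high? p (subst (T ∘ not) (sym le) tt))
  from : e ∈ lowerPart a X ++ upperPart a X → e ∈ X
  from p with ∈-++⁻ (lowerPart a X) p
  ... | inj₁ q = proj₁ (∈-filter⁻ low? {xs = X} q)
  ... | inj₂ q = proj₁ (∈-filter⁻ high? {xs = X} q)

lower-below-upper : ∀ a (X : Tableau) → LabelsBelow (lowerPart a X) (upperPart a X)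
lower-below-upper a X {i} {j} (_ , p) (_ , q) = ≤-<-trans i≤a (≰⇒> λ j≤a → not-both j>a (≤⇒≤ᵇ j≤a))
  where
  i≤a : i ≤ a
  i≤a = ≤ᵇ⇒≤ i a (proj₂ (∈-filter⁻ (T? ∘ λ e → proj₂ e ≤ᵇ a) {xs = X} p))
  j>a : T (not (j ≤ᵇ a))
  j>a = proj₂ (∈-filter⁻ (T? ∘ λ e → not (proj₂ e ≤ᵇ a)) {xs = X} q)
  not-both : ∀ {v} → T (not v) → T v → ⊥
  not-both {false} _ ()
  not-both {true}  () _

lemma3p3 : (ν λ′ : List ℕ) (T R : Tableau) (a : ℕ)
    → IsIncreasingTableau T ν λ′
    → IsIncreasingTableau R λ′ []
    → Kinfusion₁ R T
        ≐ (Kinfusion₁ R (lowerPart a T)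
            ∪ₜ Kinfusion₁ (Kinfusion₂ R (lowerPart a T)) (upperPart a T))
lemma3p3 ν λ′ T R a T-inc R-inc = ∼⇒≐ (begin
  Kinfusion₁ R T                     ≡⟨ cong proj₁ (Kinfusion-unfold R T) ⟩
  infuse₁ R ms T                     ≈⟨ infuse-split R P ms (descending-labels-distinct R) P-agrees
                                                     (lower-upper-split a T) (lower-below-upper a T) ⟩
  infuse₁ R ms A ++ infuse₁ P ms B   ≡⟨ cong₂ _++_ (cong proj₁ (Kinfusion-unfold R A)) B-side ⟨
  Kinfusion₁ R A ++ Kinfusion₁ P B   ∎)
  where
  open SetoidReasoning ([ set ]-Equality Entry)
  A B P : Tableau
  A = lowerPart a T
  B = upperPart a T
  P = Kinfusion₂ R A
  ms : List ℕ
  ms = reverse (labelsOf R)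

  P-agrees : AgreeOn ms P (infuse₂ R ms A)
  P-agrees _ = SetEq.reflexive (cong (boxesWith _ ∘ proj₂) (Kinfusion-unfold R A))

  B-side : Kinfusion₁ P B ≡ infuse₁ P ms B
  B-side = trans (cong proj₁ (Kinfusion-unfold P B)) (cong (λ L → infuse₁ P (reverse L) B)
    (labelsOf-Kinfusion₂ R A (increasing-separated R-inc)
       (Separated-⊆ (map⁺ _ (lowerPart-⊆ a T)) (increasing-separated T-inc))))
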